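{- Let $(s\,|\,c)$ be an $l$-multipartition datum and $\lambda=(\lambda^{(1)},\dots,\lambda^{(l)})\in\mathcal{C}_{(s|c)}$. Then each component $\lambda^{(k)}$ is an $s$-core.
   Context: For a partition $\nu$, the hook of a node $(a,b)$ is the set of nodes of $\nu$ directly right of or directly below $(a,b)$, including $(a,b)$; for $s\ge1$, $\nu$ is an $s$-core if it has no hook of length $s$; every partition is a $0$-core. An $l$-multipartition is an $l$-tuple of partitions with nodes $(a,b,k)$, $b\le\lambda^{(k)}_a$. An $l$-multipartition datum is $(s\,|\,c)$ with $s\in\{0,1,2,\dots\}$, $c\in\mathbb{Z}^l$. The $(s\,|\,c)$-residue of $(a,b,k)$ is $b-a+c_k+s\mathbb{Z}$ (the integer $b-a+c_k$ if $s=0$); the content is the multiset of residues of the nodes; $\lambda$ is an $(s\,|\,c)$-core if no other $l$-multipartition has the same content, except that for $s=1$ the only $(1\,|\,c)$-core is $(\varnothing,\dots,\varnothing)$. $\mathcal{C}_{(s|c)}$ is the set of $(s\,|\,c)$-cores. -}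

module Defs where

open import Data.Nat as ℕ using (ℕ; zero; suc; _≤_; _≤?_; _∸_; _≥_)
open import Data.Integer as ℤ using (ℤ; +_)
open import Data.Integer.DivMod using (_%ℕ_)
open import Data.List using (List; []; _∷_; length; filter; drop; map; concat; upTo; _++_)
open import Data.List.Relation.Unary.All using (All)
open import Data.List.Relation.Unary.Linked using (Linked)
open import Data.List.Relation.Binary.Permutation.Propositional using (_↭_)
open import Data.List.Membership.Propositional using (_∈_)
open import Data.Vec using (Vec; toList; zipWith; lookup)
import Data.Vec as Vec
open import Data.Fin using (Fin)
open import Data.Product using (Σ; _×_; _,_; proj₁)
open import Data.Sum using (_⊎_)
open import Relation.Binary.PropositionalEquality using (_≡_)
open import Relation.Nullary using (¬_)

record Partition : Set where
  constructor mkPartition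
  field
    parts     : List ℕ
    positive  : All (λ p → 1 ≤ p) parts
    decreasing : Linked _≥_ parts
open Partition public

-- Hook lengths of all nodes of a list of rows.
-- Node (a,b) in row with length p (1 ≤ b ≤ p): arm = p - b,
-- leg = number of later rows of length ≥ b; hook = arm + leg + 1.
hookLengths : List ℕ → List ℕ
hookLengths [] = []
hookLengths (p ∷ ps) =
  map (λ b → suc ((p ∸ suc b) ℕ.+ length (filter (λ q → suc b ≤? q) ps))) (upTo p)
  ++ hookLengths ps

IsSCore : ℕ → Partition → Set
IsSCore s ν = (s ≡ 0) ⊎ (¬ (s ∈ hookLengths (parts ν)))

Multipartition : ℕ → Set
Multipartition l = Vec Partition l

-- (s|c)-residue of an integer b - a + c_k, represented canonically:
-- the integer itself if s = 0, else its least non-negative residue mod s.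
canonRes : ℕ → ℤ → ℤ
canonRes zero x = x
canonRes (suc n) x = + (x %ℕ suc n)

-- residues (b - a + c_k) of all nodes of a single component with charge ck;
-- rows numbered a = 1,2,..., columns b = 1..λ_a
rowsContent : ℕ → ℤ → ℕ → List ℕ → List ℤ
rowsContent s ck a [] = []
rowsContent s ck a (p ∷ ps) =
  map (λ b → canonRes s ((+ suc b ℤ.- + a) ℤ.+ ck)) (upTo p) ++ rowsContent s ck (suc a) ps

-- content of a multipartition (as a list, compared up to permutation = multiset)
content : ∀ {l} → ℕ → Vec ℤ l → Multipartition l → List ℤ
content s c mp = concat (toList (zipWith (λ ck ν → rowsContent s ck 1 (parts ν)) c mp))

underlying : ∀ {l} → Multipartition l → Vec (List ℕ) l
underlying = Vec.map parts

IsEmptyMP : ∀ {l} → Multipartition l → Set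
IsEmptyMP mp = All (λ ps → ps ≡ []) (toList (underlying mp))

IsMPCore : ∀ {l} → ℕ → Vec ℤ l → Multipartition l → Set
IsMPCore (suc zero) c mp = IsEmptyMP mp
IsMPCore s c mp = ∀ μ → content s c μ ↭ content s c mp → underlying μ ≡ underlying mp

-- For s = 0 there is nothing to prove, and for s = 1 every component of a core is empty.
-- Let s ≥ 2 and suppose the component ν has a hook of length s. Removing the corresponding
-- rim hook leaves a partition μ, and since the s nodes of a rim hook lie on s consecutive
-- diagonals they carry each residue modulo s exactly once. The same holds for s nodes added
-- to the first row of μ, or for a column of s nodes added below μ, so both partitions obtained
-- this way have the same residue content as ν. They have different numbers of rows, so one of
-- them differs from ν; putting it in place of ν contradicts the core property.

module Submission where

open import Defs
open import Data.Nat as ℕ using (ℕ; zero; suc; _≤_; _<_; _≥_; _∸_; z≤n; s≤s; _≤?_)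
import Data.Nat.Properties as ℕₚ
open import Data.Nat.DivMod using (_%_; m%n<n; [m+n]%n≡m%n; m<n⇒m%n≡m; n%n≡0; m≤n⇒[n∸m]%m≡n%m)
import Data.Nat.Tactic.RingSolver as ℕ-Solver
open import Data.Integer.Base as ℤ using (ℤ; +_; -[1+_]; 0ℤ; 1ℤ; _+_; _-_; _⊖_)
import Data.Integer.Properties as ℤₚ
import Data.Integer.Tactic.RingSolver as ℤ-Solver
open import Data.List.Base using (List; []; _∷_; _++_; [_]; map; filter; length; replicate; applyUpTo; upTo)
import Data.List.Properties as Listₚ
open import Data.List.Properties using (≡-dec)
open import Data.List.Relation.Binary.Permutation.Propositional using (_↭_; ↭-refl; ↭-reflexive; ↭-sym; ↭-trans; prep; module PermutationReasoning)
open import Data.List.Relation.Binary.Permutation.Propositional.Properties using (++-comm; ++⁺ˡ; ++⁺ʳ; map⁺; ++-commutativeMonoid)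
open import Algebra.Bundles using (CommutativeMonoid)
open import Algebra.Properties.CommutativeSemigroup
  (CommutativeMonoid.commutativeSemigroup (++-commutativeMonoid {A = ℤ})) using (interchange; xy∙z≈xz∙y)
open import Data.List.Relation.Unary.All as All using (All; []; _∷_)
open import Data.List.Relation.Unary.Linked as Linked using (Linked; []; [-]; _∷_)
open import Data.List.Relation.Unary.Linked.Properties using (Linked⇒All; ∷-filter⁺)
import Data.List.Relation.Unary.All.Properties as Allₚ
open import Data.List.Membership.Propositional using (_∈_)
open import Data.List.Membership.Propositional.Properties using (∈-++⁻; ∈-map⁻; ∈-upTo⁻)
open import Data.Vec.Base using (Vec; _∷_; lookup; _[_]≔_)
import Data.Vec.Properties as Vecₚ
open import Data.Fin.Base as Fin using (Fin)
open import Data.Product using (Σ; _×_; _,_)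
open import Data.Sum using (inj₁; inj₂)
open import Relation.Nullary using (Dec; yes; no; ¬_)
open import Relation.Binary.Definitions using (Transitive)
open import Relation.Binary.PropositionalEquality using (_≡_; _≢_; refl; subst₂; sym; trans; cong; cong₂; subst; module ≡-Reasoning)

%ℕ-negative : ∀ n d → -[1+ n ] ℤ.%ℕ suc d ≡ (suc d ∸ suc n % suc d) % suc d
%ℕ-negative n d with suc n % suc d | m%n<n (suc n) (suc d)
... | zero  | _   = sym (n%n≡0 (suc d))
... | suc r | r<d = sym (m<n⇒m%n≡m (ℕₚ.∸-monoʳ-< (s≤s z≤n) (ℕₚ.<⇒≤ r<d)))

[d∸m]%d≡[d∸m%d]%d : ∀ {m} d → m ≤ suc d → (suc d ∸ m) % suc d ≡ (suc d ∸ m % suc d) % suc d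
[d∸m]%d≡[d∸m%d]%d {m} d m≤d with ℕₚ.m≤n⇒m<n∨m≡n m≤d
... | inj₁ m<d  = cong (λ r → (suc d ∸ r) % suc d) (sym (m<n⇒m%n≡m m<d))
... | inj₂ refl = begin
  (suc d ∸ suc d) % suc d          ≡⟨ cong (_% suc d) (ℕₚ.n∸n≡0 (suc d)) ⟩
  0                                ≡⟨ sym (n%n≡0 (suc d)) ⟩
  suc d % suc d                    ≡⟨ cong (λ r → (suc d ∸ r) % suc d) (sym (n%n≡0 (suc d))) ⟩
  (suc d ∸ suc d % suc d) % suc d  ∎
  where open ≡-Reasoning

%ℕ-periodic : ∀ z d → (z + + suc d) ℤ.%ℕ suc d ≡ z ℤ.%ℕ suc d
%ℕ-periodic (+ n)    d = [m+n]%n≡m%n n (suc d)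
%ℕ-periodic -[1+ n ] d with ℕₚ.≤-<-connex (suc n) (suc d)
... | inj₁ n≤d = begin
  (suc d ⊖ suc n) ℤ.%ℕ suc d           ≡⟨ cong (ℤ._%ℕ suc d) (ℤₚ.⊖-≥ n≤d) ⟩
  (suc d ∸ suc n) % suc d               ≡⟨ [d∸m]%d≡[d∸m%d]%d d n≤d ⟩
  (suc d ∸ suc n % suc d) % suc d       ≡⟨ sym (%ℕ-negative n d) ⟩
  -[1+ n ] ℤ.%ℕ suc d                   ∎
  where open ≡-Reasoning
... | inj₂ d<n = begin
  (suc d ⊖ suc n) ℤ.%ℕ suc d                     ≡⟨ cong (ℤ._%ℕ suc d) (ℤₚ.⊖-< d<n) ⟩
  (ℤ.- + (suc n ∸ suc d)) ℤ.%ℕ suc d             ≡⟨ cong (λ k → (ℤ.- + k) ℤ.%ℕ suc d) n-d≡1+[n∸1+d] ⟩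
  -[1+ n ∸ suc d ] ℤ.%ℕ suc d                    ≡⟨ %ℕ-negative (n ∸ suc d) d ⟩
  (suc d ∸ suc (n ∸ suc d) % suc d) % suc d      ≡⟨ cong (λ k → (suc d ∸ k % suc d) % suc d) (sym n-d≡1+[n∸1+d]) ⟩
  (suc d ∸ (suc n ∸ suc d) % suc d) % suc d      ≡⟨ cong (λ k → (suc d ∸ k) % suc d) (m≤n⇒[n∸m]%m≡n%m (ℕₚ.<⇒≤ d<n)) ⟩
  (suc d ∸ suc n % suc d) % suc d                ≡⟨ sym (%ℕ-negative n d) ⟩
  -[1+ n ] ℤ.%ℕ suc d                            ∎
  where
  open ≡-Reasoning
  n-d≡1+[n∸1+d] : suc n ∸ suc d ≡ suc (n ∸ suc d)
  n-d≡1+[n∸1+d] = ℕₚ.+-∸-assoc 1 (ℕₚ.≤-pred d<n)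

residue : ℕ → ℤ → ℤ → ℤ
residue s ck d = canonRes s (d + ck)

residue-periodic : ∀ n ck z → residue (suc n) ck (z + + suc n) ≡ residue (suc n) ck z
residue-periodic n ck z = cong +_ (begin
  ((z + + suc n) + ck) ℤ.%ℕ suc n  ≡⟨ cong (ℤ._%ℕ suc n) (right-comm z (+ suc n) ck) ⟩
  ((z + ck) + + suc n) ℤ.%ℕ suc n  ≡⟨ %ℕ-periodic (z + ck) n ⟩
  (z + ck) ℤ.%ℕ suc n              ∎)
  where
  open ≡-Reasoning
  right-comm : ∀ x y z → (x + y) + z ≡ (x + z) + y
  right-comm = ℤ-Solver.solve-∀

run : ℤ → ℕ → List ℤ
run x zero    = []
run x (suc n) = x ∷ run (x + 1ℤ) n

run-++ : ∀ x m n → run x (m ℕ.+ n) ≡ run x m ++ run (x + + m) n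
run-++ x zero    n = cong (λ y → run y n) (sym (ℤₚ.+-identityʳ x))
run-++ x (suc m) n = cong (x ∷_) (begin
  run (x + 1ℤ) (m ℕ.+ n)                       ≡⟨ run-++ (x + 1ℤ) m n ⟩
  run (x + 1ℤ) m ++ run ((x + 1ℤ) + + m) n     ≡⟨ cong (λ y → run (x + 1ℤ) m ++ run y n) (ℤₚ.+-assoc x 1ℤ (+ m)) ⟩
  run (x + 1ℤ) m ++ run (x + + suc m) n        ∎)
  where open ≡-Reasoning

run-join : ∀ {y z} m n → y + + m ≡ z → run y m ++ run z n ≡ run y (m ℕ.+ n)
run-join {y} m n refl = sym (run-++ y m n)

run-snoc : ∀ x n → run x (suc n) ≡ run x n ++ [ x + + n ]
run-snoc x zero    = cong [_] (sym (ℤₚ.+-identityʳ x))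
run-snoc x (suc n) = cong (x ∷_) (trans (run-snoc (x + 1ℤ) n)
  (cong (λ y → run (x + 1ℤ) n ++ [ y ]) (ℤₚ.+-assoc x 1ℤ (+ n))))

map-run-step : ∀ (f : ℤ → ℤ) n → (∀ z → f (z + + n) ≡ f z) →
               ∀ x → map f (run (x + 1ℤ) n) ↭ map f (run x n)
map-run-step f zero    periodic x = ↭-refl
map-run-step f (suc n) periodic x = begin
  map f (run (x + 1ℤ) (suc n))                     ≡⟨ cong (map f) (run-snoc (x + 1ℤ) n) ⟩
  map f (run (x + 1ℤ) n ++ [ (x + 1ℤ) + + n ])     ≡⟨ Listₚ.map-++ f (run (x + 1ℤ) n) _ ⟩
  map f (run (x + 1ℤ) n) ++ [ f ((x + 1ℤ) + + n) ] ≡⟨ cong (λ y → map f (run (x + 1ℤ) n) ++ [ y ])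
                                                      (trans (cong f (ℤₚ.+-assoc x 1ℤ (+ n))) (periodic x)) ⟩
  map f (run (x + 1ℤ) n) ++ [ f x ]                ↭⟨ ++-comm (map f (run (x + 1ℤ) n)) [ f x ] ⟩
  f x ∷ map f (run (x + 1ℤ) n)                     ∎
  where open PermutationReasoning

module _ (f : ℤ → ℤ) (n : ℕ) (periodic : ∀ z → f (z + + n) ≡ f z) where

  map-run-shift : ∀ k x → map f (run (x + + k) n) ↭ map f (run x n)
  map-run-shift zero    x = ↭-reflexive (cong (λ y → map f (run y n)) (ℤₚ.+-identityʳ x))
  map-run-shift (suc k) x = begin
    map f (run (x + + suc k) n)     ≡⟨ cong (λ y → map f (run y n)) (sym (ℤₚ.+-assoc x 1ℤ (+ k))) ⟩
    map f (run ((x + 1ℤ) + + k) n)  ↭⟨ map-run-shift k (x + 1ℤ) ⟩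
    map f (run (x + 1ℤ) n)          ↭⟨ map-run-step f n periodic x ⟩
    map f (run x n)                 ∎
    where open PermutationReasoning

  map-run-to-0 : ∀ x → map f (run x n) ↭ map f (run 0ℤ n)
  map-run-to-0 (+ k)    = map-run-shift k 0ℤ
  map-run-to-0 -[1+ k ] = ↭-sym (begin
    map f (run 0ℤ n)                      ≡⟨ cong (λ y → map f (run y n)) (sym (ℤₚ.+-inverseˡ (+ suc k))) ⟩
    map f (run (-[1+ k ] + + suc k) n)    ↭⟨ map-run-shift (suc k) -[1+ k ] ⟩
    map f (run -[1+ k ] n)                ∎)
    where open PermutationReasoning

  map-run-invariant : ∀ x y → map f (run x n) ↭ map f (run y n)
  map-run-invariant x y = ↭-trans (map-run-to-0 x) (↭-sym (map-run-to-0 y))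

-- The contents b − a of the nodes (a, b) of a diagram, shifted so that node (1, 1) has content x.
diagonals : ℤ → List ℕ → List ℤ
diagonals x []       = []
diagonals x (p ∷ ps) = run x p ++ diagonals (x - 1ℤ) ps

applyUpTo-run : ∀ {A : Set} (g : ℤ → A) (h : ℕ → A) x n → (∀ b → h b ≡ g (x + + b)) →
                applyUpTo h n ≡ map g (run x n)
applyUpTo-run g h x zero    h≗g = refl
applyUpTo-run g h x (suc n) h≗g = cong₂ _∷_
  (trans (h≗g 0) (cong g (ℤₚ.+-identityʳ x)))
  (applyUpTo-run g (λ b → h (suc b)) (x + 1ℤ) n λ b → trans (h≗g (suc b)) (cong g (sym (ℤₚ.+-assoc x 1ℤ (+ b)))))

rowsContent≡residues : ∀ s ck a rows →
  rowsContent s ck a rows ≡ map (residue s ck) (diagonals (1ℤ - + a) rows)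
rowsContent≡residues s ck a []       = refl
rowsContent≡residues s ck a (p ∷ ps) = begin
  map (λ b → residue s ck (+ suc b - + a)) (upTo p) ++ rowsContent s ck (suc a) ps
    ≡⟨ cong₂ _++_ first-row (rowsContent≡residues s ck (suc a) ps) ⟩
  map (residue s ck) (run (1ℤ - + a) p) ++ map (residue s ck) (diagonals (1ℤ - + suc a) ps)
    ≡⟨ cong (λ x → map (residue s ck) (run (1ℤ - + a) p) ++ map (residue s ck) (diagonals x ps)) row-step ⟩
  map (residue s ck) (run (1ℤ - + a) p) ++ map (residue s ck) (diagonals ((1ℤ - + a) - 1ℤ) ps)
    ≡⟨ sym (Listₚ.map-++ (residue s ck) (run (1ℤ - + a) p) _) ⟩
  map (residue s ck) (diagonals (1ℤ - + a) (p ∷ ps)) ∎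
  where
  open ≡-Reasoning
  first-row : map (λ b → residue s ck (+ suc b - + a)) (upTo p) ≡ map (residue s ck) (run (1ℤ - + a) p)
  first-row = trans (Listₚ.map-upTo _ p) (applyUpTo-run (residue s ck) _ (1ℤ - + a) p
    λ b → cong (residue s ck) (column-diagonal (+ b) (+ a)))
    where
    column-diagonal : ∀ b a → (1ℤ + b) - a ≡ (1ℤ - a) + b
    column-diagonal = ℤ-Solver.solve-∀
  row-step : 1ℤ - + suc a ≡ (1ℤ - + a) - 1ℤ
  row-step = descend (+ a)
    where
    descend : ∀ a → 1ℤ - (1ℤ + a) ≡ (1ℤ - a) - 1ℤ
    descend = ℤ-Solver.solve-∀

diagonals-++ : ∀ x xs ys → diagonals x (xs ++ ys) ≡ diagonals x xs ++ diagonals (x - + length xs) ys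
diagonals-++ x []       ys = cong (λ z → diagonals z ys) (sym (ℤₚ.+-identityʳ x))
diagonals-++ x (p ∷ xs) ys = begin
  run x p ++ diagonals (x - 1ℤ) (xs ++ ys)
    ≡⟨ cong (run x p ++_) (diagonals-++ (x - 1ℤ) xs ys) ⟩
  run x p ++ (diagonals (x - 1ℤ) xs ++ diagonals ((x - 1ℤ) - + length xs) ys)
    ≡⟨ sym (Listₚ.++-assoc (run x p) _ _) ⟩
  diagonals x (p ∷ xs) ++ diagonals ((x - 1ℤ) - + length xs) ys
    ≡⟨ cong (λ z → diagonals x (p ∷ xs) ++ diagonals z ys) (descend x (+ length xs)) ⟩
  diagonals x (p ∷ xs) ++ diagonals (x - + length (p ∷ xs)) ys ∎
  where
  open ≡-Reasoning
  descend : ∀ x l → (x - 1ℤ) - l ≡ x - (1ℤ + l)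
  descend = ℤ-Solver.solve-∀

diagonals-column : ∀ n y → diagonals (y + + n) (replicate (suc n) 1) ↭ run y (suc n)
diagonals-column zero    y = ↭-reflexive (cong [_] (ℤₚ.+-identityʳ y))
diagonals-column (suc n) y = begin
  top ∷ diagonals (top - 1ℤ) (replicate (suc n) 1)
    ≡⟨ cong (λ z → top ∷ diagonals z (replicate (suc n) 1)) (descend y (+ n)) ⟩
  top ∷ diagonals (y + + n) (replicate (suc n) 1)
    ↭⟨ prep top (diagonals-column n y) ⟩
  top ∷ run y (suc n)
    ↭⟨ ++-comm [ top ] (run y (suc n)) ⟩
  run y (suc n) ++ [ top ]
    ≡⟨ sym (run-snoc y (suc n)) ⟩
  run y (suc (suc n)) ∎
  where
  open PermutationReasoning
  top : ℤ
  top = y + + suc n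
  descend : ∀ y n → (y + (1ℤ + n)) - 1ℤ ≡ y + n
  descend = ℤ-Solver.solve-∀

≥-trans : Transitive _≥_
≥-trans i≥j j≥k = ℕₚ.≤-trans j≥k i≥j

diagonals-of-zero-rows : ∀ x {rows} → All (0 ≥_) rows → diagonals x rows ≡ []
diagonals-of-zero-rows x []          = refl
diagonals-of-zero-rows x (z≤n ∷ zs) = diagonals-of-zero-rows (x - 1ℤ) zs

diagonals-filter-nonzero : ∀ x {rows} → Linked _≥_ rows → diagonals x (filter (1 ≤?_) rows) ≡ diagonals x rows
diagonals-filter-nonzero x {[]}         _  = refl
diagonals-filter-nonzero x {zero ∷ rs}  lk = begin
  diagonals x (filter (1 ≤?_) rs)   ≡⟨ cong (diagonals x) (Listₚ.filter-none (1 ≤?_) (All.map (λ { z≤n () }) zeros)) ⟩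
  []                                ≡⟨ sym (diagonals-of-zero-rows (x - 1ℤ) zeros) ⟩
  diagonals (x - 1ℤ) rs             ∎
  where
  open ≡-Reasoning
  zeros : All (0 ≥_) rs
  zeros = All.tail (Linked⇒All ≥-trans {v = 0} z≤n lk)
diagonals-filter-nonzero x {suc r ∷ rs} lk =
  cong (run x (suc r) ++_) (diagonals-filter-nonzero (x - 1ℤ) (Linked.tail lk))

StripExtension : ℕ → ℤ → List ℕ → List ℕ → Set
StripExtension n x μ ν = Σ ℤ λ y → diagonals x ν ↭ diagonals x μ ++ run y n

stripExtensions-agree : ∀ {n x μ ν ν′} (f : ℤ → ℤ) → (∀ z → f (z + + n) ≡ f z) →
  StripExtension n x μ ν → StripExtension n x μ ν′ → map f (diagonals x ν) ↭ map f (diagonals x ν′)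
stripExtensions-agree {n} {x} {μ} {ν} {ν′} f periodic (y , strip) (y′ , strip′) = begin
  map f (diagonals x ν)                        ↭⟨ map⁺ f strip ⟩
  map f (diagonals x μ ++ run y n)             ≡⟨ Listₚ.map-++ f (diagonals x μ) _ ⟩
  map f (diagonals x μ) ++ map f (run y n)     ↭⟨ ++⁺ˡ (map f (diagonals x μ)) (map-run-invariant f n periodic y y′) ⟩
  map f (diagonals x μ) ++ map f (run y′ n)    ≡⟨ sym (Listₚ.map-++ f (diagonals x μ) _) ⟩
  map f (diagonals x μ ++ run y′ n)            ↭⟨ map⁺ f (↭-sym strip′) ⟩
  map f (diagonals x ν′)                       ∎
  where open PermutationReasoning

raise-head : ∀ {x y xs} → x ≤ y → Linked _≥_ (x ∷ xs) → Linked _≥_ (y ∷ xs)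
raise-head x≤y [-]      = [-]
raise-head x≤y (h ∷ lk) = ℕₚ.≤-trans h x≤y ∷ lk

leg : ℕ → List ℕ → ℕ
leg b ps = length (filter (λ q → suc b ≤? q) ps)

hookLength : ℕ → List ℕ → ℕ → ℕ
hookLength p ps b = suc ((p ∸ suc b) ℕ.+ leg b ps)

-- The rows replacing p ∷ ps when the rim hook of node (1, b + 1) is removed: each row of ps
-- longer than b loses its last node and moves up, and the first shorter row is preceded by a
-- row of length b. The result ends in rows of length 0 when b = 0.
removeRimHook : ℕ → List ℕ → List ℕ
removeRimHook b []       = b ∷ []
removeRimHook b (q ∷ qs) with suc b ≤? q
... | yes _ = ℕ.pred q ∷ removeRimHook b qs
... | no  _ = b ∷ q ∷ qs

leg-accept : ∀ {b q} qs → suc b ≤ q → leg b (q ∷ qs) ≡ suc (leg b qs)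
leg-accept {b} qs b<q = cong length (Listₚ.filter-accept (λ q → suc b ≤? q) b<q)

leg-of-short-rows : ∀ {b qs} → All (b ≥_) qs → leg b qs ≡ 0
leg-of-short-rows {b} qs≤b = cong length (Listₚ.filter-none (λ q → suc b ≤? q) (All.map ℕₚ.≤⇒≯ qs≤b))

removeRimHook-linked : ∀ {b q} ps → b < q → Linked _≥_ (q ∷ ps) → Linked _≥_ (ℕ.pred q ∷ removeRimHook b ps)
removeRimHook-linked         []        b<q lk = ℕₚ.<⇒≤pred b<q ∷ [-]
removeRimHook-linked {b} {q} (q₁ ∷ qs) b<q lk with suc b ≤? q₁
... | yes b<q₁ = ℕₚ.pred-mono-≤ (Linked.head lk) ∷ removeRimHook-linked qs b<q₁ (Linked.tail lk)
... | no  q₁≤b = ℕₚ.<⇒≤pred b<q ∷ ℕₚ.≮⇒≥ q₁≤b ∷ Linked.tail lk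

rimHook-in-first-row : ∀ x b k R →
  run x (suc (b ℕ.+ k)) ++ R ↭ (run x b ++ R) ++ run (x + + b - + 0) (suc (k ℕ.+ 0))
rimHook-in-first-row x b k R = begin
  run x (suc (b ℕ.+ k)) ++ R
    ≡⟨ cong (_++ R) (trans (cong (run x) (sym (ℕₚ.+-suc b k))) (run-++ x b (suc k))) ⟩
  (run x b ++ run (x + + b) (suc k)) ++ R
    ↭⟨ xy∙z≈xz∙y (run x b) _ R ⟩
  (run x b ++ R) ++ run (x + + b) (suc k)
    ≡⟨ cong₂ (λ y n → (run x b ++ R) ++ run y (suc n)) (sym (ℤₚ.+-identityʳ (x + + b))) (sym (ℕₚ.+-identityʳ k)) ⟩
  (run x b ++ R) ++ run (x + + b - + 0) (suc (k ℕ.+ 0)) ∎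
  where open PermutationReasoning

-- The lowest node of the rim hook is in row leg + 1 and column b + 1, on diagonal x + b − leg.
diagonals-removeRimHook : ∀ x b k ps → Linked _≥_ (suc (b ℕ.+ k) ∷ ps) →
  diagonals x (suc (b ℕ.+ k) ∷ ps) ↭
  diagonals x (removeRimHook b ps) ++ run (x + + b - + leg b ps) (suc (k ℕ.+ leg b ps))
diagonals-removeRimHook x b k []       lk = rimHook-in-first-row x b k []
diagonals-removeRimHook x b k (q ∷ qs) lk with suc b ≤? q
... | no q≤b rewrite leg-of-short-rows (Linked⇒All ≥-trans (ℕₚ.≮⇒≥ q≤b) (Linked.tail lk)) =
  rimHook-in-first-row x b k (diagonals (x - 1ℤ) (q ∷ qs))
... | yes b<q with ℕₚ.m≤n⇒∃[o]m+o≡n b<q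
...   | j , refl with ℕₚ.m≤n⇒∃[o]m+o≡n (ℕₚ.+-cancelˡ-≤ b j k (ℕₚ.≤-pred (Linked.head lk)))
...     | d , refl rewrite leg-accept qs b<q = begin
  run x (suc (b ℕ.+ (j ℕ.+ d))) ++ diagonals (x - 1ℤ) (suc (b ℕ.+ j) ∷ qs)
    ≡⟨ cong (_++ _) (trans (cong (run x) (split-row b j d)) (run-++ x (b ℕ.+ j) (suc d))) ⟩
  (A ++ B) ++ diagonals (x - 1ℤ) (suc (b ℕ.+ j) ∷ qs)
    ↭⟨ ++⁺ˡ (A ++ B) (diagonals-removeRimHook (x - 1ℤ) b j qs (Linked.tail lk)) ⟩
  (A ++ B) ++ (D ++ C)
    ↭⟨ interchange A B D C ⟩
  (A ++ D) ++ (B ++ C)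
    ↭⟨ ++⁺ˡ (A ++ D) (++-comm B C) ⟩
  (A ++ D) ++ (C ++ B)
    ≡⟨ cong ((A ++ D) ++_) (run-join (suc (j ℕ.+ L)) (suc d) (rim-meets-arm x (+ b) (+ j) (+ L))) ⟩
  (A ++ D) ++ run y (suc (j ℕ.+ L) ℕ.+ suc d)
    ≡⟨ cong₂ (λ y n → (A ++ D) ++ run y n) (rim-start x (+ b) (+ L)) (rim-length j d L) ⟩
  (A ++ D) ++ run (x + + b - + suc L) (suc ((j ℕ.+ d) ℕ.+ suc L))
    ∎
  where
  open PermutationReasoning
  L : ℕ
  L = leg b qs
  y : ℤ
  y = (x - 1ℤ) + + b - + L
  A B C D : List ℤ
  A = run x (b ℕ.+ j)
  B = run (x + + (b ℕ.+ j)) (suc d)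
  C = run y (suc (j ℕ.+ L))
  D = diagonals (x - 1ℤ) (removeRimHook b qs)
  split-row : ∀ b j d → suc (b ℕ.+ (j ℕ.+ d)) ≡ (b ℕ.+ j) ℕ.+ suc d
  split-row = ℕ-Solver.solve-∀
  rim-length : ∀ j d L → suc (j ℕ.+ L) ℕ.+ suc d ≡ suc ((j ℕ.+ d) ℕ.+ suc L)
  rim-length = ℕ-Solver.solve-∀
  rim-meets-arm : ∀ x b j L → ((x - 1ℤ) + b - L) + (1ℤ + (j + L)) ≡ x + (b + j)
  rim-meets-arm = ℤ-Solver.solve-∀
  rim-start : ∀ x b L → (x - 1ℤ) + b - L ≡ x + b - (1ℤ + L)
  rim-start = ℤ-Solver.solve-∀

hook⇒stripExtension : ∀ {n} x p ps → Linked _≥_ (p ∷ ps) → All (1 ≤_) (p ∷ ps) →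
  n ∈ hookLengths (p ∷ ps) →
  Σ (List ℕ) λ μ → Linked _≥_ (p ∷ μ) × All (1 ≤_) μ × StripExtension n x μ (p ∷ ps)
hook⇒stripExtension {n} x p ps lk pos n∈ with ∈-++⁻ (map (hookLength p ps) (upTo p)) n∈
... | inj₁ n∈row with ∈-map⁻ (hookLength p ps) n∈row
...   | b , b∈ , n≡hookLength with ℕₚ.m≤n⇒∃[o]m+o≡n (∈-upTo⁻ b∈)
...     | k , refl =
  filter (1 ≤?_) R , raise-head (ℕₚ.n≤1+n (b ℕ.+ k)) (∷-filter⁺ (1 ≤?_) ≥-trans linked-R) ,
  Allₚ.all-filter (1 ≤?_) R , (x + + b - + leg b ps , strip)
  where
  open PermutationReasoning
  R : List ℕ
  R = removeRimHook b ps
  linked-R : Linked _≥_ (b ℕ.+ k ∷ R)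
  linked-R = removeRimHook-linked ps (s≤s (ℕₚ.m≤m+n b k)) lk
  hook-length : n ≡ suc (k ℕ.+ leg b ps)
  hook-length = trans n≡hookLength (cong (λ a → suc (a ℕ.+ leg b ps)) (ℕₚ.m+n∸m≡n b k))
  strip : diagonals x (suc (b ℕ.+ k) ∷ ps) ↭ diagonals x (filter (1 ≤?_) R) ++ run (x + + b - + leg b ps) n
  strip = begin
    diagonals x (suc (b ℕ.+ k) ∷ ps)                     ↭⟨ diagonals-removeRimHook x b k ps lk ⟩
    diagonals x R ++ run (x + + b - + leg b ps) (suc (k ℕ.+ leg b ps))
      ≡⟨ cong₂ (λ ds m → ds ++ run (x + + b - + leg b ps) m)
               (sym (diagonals-filter-nonzero x (Linked.tail linked-R))) (sym hook-length) ⟩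
    diagonals x (filter (1 ≤?_) R) ++ run (x + + b - + leg b ps) n ∎
hook⇒stripExtension x p (p′ ∷ ps′) lk (1≤p ∷ pos) n∈ | inj₂ n∈rest
  with hook⇒stripExtension (x - 1ℤ) p′ ps′ (Linked.tail lk) pos n∈rest
... | μ , lkμ , posμ , (y , strip) =
  p ∷ μ , ℕₚ.≤-refl ∷ raise-head (Linked.head lk) lkμ , 1≤p ∷ posμ ,
  (y , ↭-trans (++⁺ˡ (run x p) strip) (↭-reflexive (sym (Listₚ.++-assoc (run x p) _ _))))

widenFirstRow : ℕ → List ℕ → List ℕ
widenFirstRow n []       = n ∷ []
widenFirstRow n (r ∷ rs) = r ℕ.+ n ∷ rs

appendColumn : ℕ → List ℕ → List ℕ
appendColumn n rows = rows ++ replicate n 1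

widenFirstRow-strip : ∀ n x rows → StripExtension n x rows (widenFirstRow n rows)
widenFirstRow-strip n x []       = x , ↭-reflexive (Listₚ.++-identityʳ (run x n))
widenFirstRow-strip n x (r ∷ rs) = x + + r , (begin
  run x (r ℕ.+ n) ++ D                  ≡⟨ cong (_++ D) (run-++ x r n) ⟩
  (run x r ++ run (x + + r) n) ++ D     ↭⟨ xy∙z≈xz∙y (run x r) _ D ⟩
  (run x r ++ D) ++ run (x + + r) n     ∎)
  where
  open PermutationReasoning
  D : List ℤ
  D = diagonals (x - 1ℤ) rs

widenFirstRow-linked : ∀ n {rows} → Linked _≥_ rows → Linked _≥_ (widenFirstRow n rows)
widenFirstRow-linked n {[]}     _  = [-]
widenFirstRow-linked n {r ∷ rs} lk = raise-head (ℕₚ.m≤m+n r n) lk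

widenFirstRow-positive : ∀ {n rows} → 1 ≤ n → All (1 ≤_) rows → All (1 ≤_) (widenFirstRow n rows)
widenFirstRow-positive 1≤n []         = 1≤n ∷ []
widenFirstRow-positive 1≤n (1≤r ∷ pos) = ℕₚ.≤-trans 1≤r (ℕₚ.m≤m+n _ _) ∷ pos

length-widenFirstRow : ∀ n rows → length (widenFirstRow n rows) ≤ suc (length rows)
length-widenFirstRow n []       = ℕₚ.≤-refl
length-widenFirstRow n (r ∷ rs) = ℕₚ.n≤1+n _

appendColumn-strip : ∀ n x rows → StripExtension (suc n) x rows (appendColumn (suc n) rows)
appendColumn-strip n x rows = y , (begin
  diagonals x (rows ++ replicate (suc n) 1)
    ≡⟨ diagonals-++ x rows (replicate (suc n) 1) ⟩
  diagonals x rows ++ diagonals (x - + length rows) (replicate (suc n) 1)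
    ≡⟨ cong (λ z → diagonals x rows ++ diagonals z (replicate (suc n) 1)) (sym (cancel (x - + length rows) (+ n))) ⟩
  diagonals x rows ++ diagonals (y + + n) (replicate (suc n) 1)
    ↭⟨ ++⁺ˡ (diagonals x rows) (diagonals-column n y) ⟩
  diagonals x rows ++ run y (suc n) ∎)
  where
  open PermutationReasoning
  y : ℤ
  y = (x - + length rows) - + n
  cancel : ∀ z n → (z - n) + n ≡ z
  cancel = ℤ-Solver.solve-∀

replicate-linked : ∀ n → Linked _≥_ (replicate n 1)
replicate-linked zero          = []
replicate-linked (suc zero)    = [-]
replicate-linked (suc (suc n)) = ℕₚ.≤-refl ∷ replicate-linked (suc n)

appendColumn-linked : ∀ n {rows} → Linked _≥_ rows → All (1 ≤_) rows → Linked _≥_ (appendColumn n rows)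
appendColumn-linked n       []       _         = replicate-linked n
appendColumn-linked zero    [-]      _         = [-]
appendColumn-linked (suc n) [-]      (1≤r ∷ _) = 1≤r ∷ replicate-linked (suc n)
appendColumn-linked n       (h ∷ lk) (_ ∷ pos) = h ∷ appendColumn-linked n lk pos

appendColumn-positive : ∀ n {rows} → All (1 ≤_) rows → All (1 ≤_) (appendColumn n rows)
appendColumn-positive n pos = Allₚ.++⁺ pos (Allₚ.replicate⁺ n ℕₚ.≤-refl)

widenFirstRow≢appendColumn : ∀ m rows → widenFirstRow (2 ℕ.+ m) rows ≢ appendColumn (2 ℕ.+ m) rows
widenFirstRow≢appendColumn m rows eq = ℕₚ.<⇒≢ shorter (cong length eq)
  where
  open ℕₚ.≤-Reasoning
  l : ℕ
  l = length rows
  shorter : length (widenFirstRow (2 ℕ.+ m) rows) < length (appendColumn (2 ℕ.+ m) rows)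
  shorter = begin-strict
    length (widenFirstRow (2 ℕ.+ m) rows)  ≤⟨ length-widenFirstRow (2 ℕ.+ m) rows ⟩
    suc l                                  ≡⟨ ℕₚ.+-comm 1 l ⟩
    l ℕ.+ 1                                <⟨ ℕₚ.+-monoʳ-< l (s≤s (s≤s z≤n)) ⟩
    l ℕ.+ (2 ℕ.+ m)                        ≡⟨ sym (trans (Listₚ.length-++ rows) (cong (l ℕ.+_) (Listₚ.length-replicate (2 ℕ.+ m)))) ⟩
    length (appendColumn (2 ℕ.+ m) rows)   ∎

hook⇒content-twin : ∀ m ck (ν : Partition) → 2 ℕ.+ m ∈ hookLengths (parts ν) →
  Σ Partition λ ν′ → rowsContent (2 ℕ.+ m) ck 1 (parts ν′) ↭ rowsContent (2 ℕ.+ m) ck 1 (parts ν)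
                   × parts ν′ ≢ parts ν
hook⇒content-twin m ck (mkPartition (p ∷ ps) pos lk) s∈ with hook⇒stripExtension 0ℤ p ps lk pos s∈
... | μ , lkμ , posμ , strip = choose (≡-dec ℕ._≟_ (widenFirstRow s μ) (p ∷ ps))
  where
  s : ℕ
  s = 2 ℕ.+ m
  wide tall : Partition
  wide = mkPartition (widenFirstRow s μ) (widenFirstRow-positive (s≤s z≤n) posμ) (widenFirstRow-linked s (Linked.tail lkμ))
  tall = mkPartition (appendColumn s μ) (appendColumn-positive s posμ) (appendColumn-linked s (Linked.tail lkμ) posμ)
  same-content : ∀ ν′ → StripExtension s 0ℤ μ (parts ν′) →
                 rowsContent s ck 1 (parts ν′) ↭ rowsContent s ck 1 (p ∷ ps)
  same-content ν′ strip′ =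
    subst₂ _↭_ (sym (rowsContent≡residues s ck 1 (parts ν′))) (sym (rowsContent≡residues s ck 1 (p ∷ ps)))
      (stripExtensions-agree {μ = μ} {ν = parts ν′} {ν′ = p ∷ ps} (residue s ck) (residue-periodic (suc m) ck) strip′ strip)
  choose : Dec (widenFirstRow s μ ≡ p ∷ ps) →
    Σ Partition λ ν′ → rowsContent s ck 1 (parts ν′) ↭ rowsContent s ck 1 (p ∷ ps) × parts ν′ ≢ p ∷ ps
  choose (yes wide≡ν) = tall , same-content tall (appendColumn-strip (suc m) 0ℤ μ) ,
                        λ tall≡ν → widenFirstRow≢appendColumn m μ (trans wide≡ν (sym tall≡ν))
  choose (no wide≢ν)  = wide , same-content wide (widenFirstRow-strip s 0ℤ μ) , wide≢ν

content-[]≔ : ∀ s {l} (c : Vec ℤ l) (λ′ : Multipartition l) k ν′ →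
  rowsContent s (lookup c k) 1 (parts ν′) ↭ rowsContent s (lookup c k) 1 (parts (lookup λ′ k)) →
  content s c (λ′ [ k ]≔ ν′) ↭ content s c λ′
content-[]≔ s (c₀ ∷ c) (ν ∷ λ′) Fin.zero    ν′ same = ++⁺ʳ _ same
content-[]≔ s (c₀ ∷ c) (ν ∷ λ′) (Fin.suc k) ν′ same = ++⁺ˡ (rowsContent s c₀ 1 (parts ν)) (content-[]≔ s c λ′ k ν′ same)

underlying-[]≔ : ∀ {l} (λ′ : Multipartition l) k ν′ →
  underlying (λ′ [ k ]≔ ν′) ≡ underlying λ′ → parts ν′ ≡ parts (lookup λ′ k)
underlying-[]≔ λ′ k ν′ eq = begin
  parts ν′                                ≡⟨ cong parts (sym (Vecₚ.lookup∘update k λ′ ν′)) ⟩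
  parts (lookup (λ′ [ k ]≔ ν′) k)          ≡⟨ sym (Vecₚ.lookup-map k parts (λ′ [ k ]≔ ν′)) ⟩
  lookup (underlying (λ′ [ k ]≔ ν′)) k     ≡⟨ cong (λ v → lookup v k) eq ⟩
  lookup (underlying λ′) k                ≡⟨ Vecₚ.lookup-map k parts λ′ ⟩
  parts (lookup λ′ k)                     ∎
  where open ≡-Reasoning

empty-component : ∀ {l} (λ′ : Multipartition l) k → IsEmptyMP λ′ → parts (lookup λ′ k) ≡ []
empty-component (ν ∷ λ′) Fin.zero    (e ∷ _)  = e
empty-component (ν ∷ λ′) (Fin.suc k) (_ ∷ es) = empty-component λ′ k es

lemma2p4 : (s l : ℕ) (c : Vec ℤ l) (λ′ : Multipartition l) →
    IsMPCore s c λ′ → (k : Fin l) → IsSCore s (lookup λ′ k)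
lemma2p4 zero          l c λ′ core k = inj₁ refl
lemma2p4 (suc zero)    l c λ′ core k =
  inj₂ (subst (λ rows → ¬ 1 ∈ hookLengths rows) (sym (empty-component λ′ k core)) λ ())
lemma2p4 (suc (suc m)) l c λ′ core k = inj₂ λ s∈ →
  let ν′ , same , differ = hook⇒content-twin m (lookup c k) (lookup λ′ k) s∈
  in differ (underlying-[]≔ λ′ k ν′ (core (λ′ [ k ]≔ ν′) (content-[]≔ (suc (suc m)) c λ′ k ν′ same)))
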